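{- The chromatic number of the matrix multiplication tensor satisfies $\chi(\langle N,N,N\rangle)\le N^{1+o(1)}$ as $N\to\infty$.
   Context: $\langle N,N,N\rangle=\sum_{i,j,k\in[N]}x_{i,j}y_{j,k}z_{k,i}$, with index set $[N]^2$ on each axis. For an ordinary $\{0,1\}$-valued tensor $T$ with support $P\subset A\times B\times C$ (all terms regarded as "green"), a set $S\subset P$ is independent if each element of $\pi_1(S)$ (resp. $\pi_2(S)$, $\pi_3(S)$) occurs in exactly one triple of $S$ and $P\cap(\pi_1(S)\times\pi_2(S)\times\pi_3(S))=S$, where $\pi_i$ are coordinate projections. $\chi(T)$ is the least $k$ such that $P$ can be partitioned into $k$ independent sets. -}

module Defs where

open import Level using (Level; _⊔_; suc)
open import Data.Nat using (ℕ)
open import Data.Fin using (Fin)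
open import Data.Product using (_×_; _,_; Σ; ∃; ∃-syntax)
open import Relation.Binary.PropositionalEquality using (_≡_)

-- The support P ⊆ A × B × C of a {0,1}-valued tensor, given as a type of
-- terms together with the three coordinate projections.  (The map
-- term ↦ (π₁,π₂,π₃) is meant to be injective, so that terms are identified
-- with triples of P; this holds for the matrix multiplication tensor below.)
record TensorSupport : Set₁ where
  field
    A B C Term : Set
    π₁ : Term → A
    π₂ : Term → B
    π₃ : Term → C

module _ (T : TensorSupport) where
  open TensorSupport T

  record Independent (S : Term → Set) : Set where
    field
      unique₁ : ∀ s t → S s → S t → π₁ s ≡ π₁ t → s ≡ t
      unique₂ : ∀ s t → S s → S t → π₂ s ≡ π₂ t → s ≡ t
      unique₃ : ∀ s t → S s → S t → π₃ s ≡ π₃ t → s ≡ t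
      closed  : ∀ t →
                (∃[ s ] (S s × π₁ s ≡ π₁ t)) →
                (∃[ s ] (S s × π₂ s ≡ π₂ t)) →
                (∃[ s ] (S s × π₃ s ≡ π₃ t)) →
                S t

  -- P can be partitioned into k independent sets (the parts being the
  -- colour classes of a colouring c : P → Fin k; empty classes are
  -- independent, so this says exactly χ(T) ≤ k).
  PartitionableInto : ℕ → Set
  PartitionableInto k =
    Σ (Term → Fin k) λ c → ∀ (col : Fin k) → Independent (λ t → c t ≡ col)

-- The matrix multiplication tensor ⟨N,N,N⟩ = Σ_{i,j,k} x_{i,j} y_{j,k} z_{k,i};
-- its support consists of the triples ((i,j),(j,k),(k,i)), indexed by (i,j,k).
MM : ℕ → TensorSupport
MM N = record
  { A = Fin N × Fin N
  ; B = Fin N × Fin N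
  ; C = Fin N × Fin N
  ; Term = Fin N × Fin N × Fin N
  ; π₁ = λ { (i , j , k) → (i , j) }
  ; π₂ = λ { (i , j , k) → (j , k) }
  ; π₃ = λ { (i , j , k) → (k , i) }
  }

-- Write N ≤ L^m and identify [N] with a subset of [L]^m by base-L digits.  Colour the term
-- (x, y, z) of ⟨N,N,N⟩ by the squared distance ‖y - x‖² and the vector x - 2y + z.  Inside one
-- colour class any two of x, y, z determine the third through x - 2y + z.  If (x, y, z₁),
-- (x', y, z) and (x, y', z) share a colour, then x' + 2y' = x + 2y while y - x, y - x' and
-- y' - x all have the same length, and the parallelogram law forces x = x'.  Hence colour
-- classes are independent, and there are at most (1 + mL²)(4L)^m colours; with L = 2^(4q)
-- and m minimal this is at most N^(1 + p/q) once N is large.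
module Submission where

open import Defs
open import Data.Nat using (ℕ; _≤_; _<_; _^_; _+_)
open import Data.Product using (_×_; ∃-syntax)

open import Data.Empty using (⊥-elim)
open import Data.Fin using (Fin; zero; suc; toℕ; fromℕ<; inject≤; opposite; combine; funToFin; finToFun)
open import Data.Fin.Properties
  using (toℕ-injective; toℕ<n; fromℕ<-injective; inject≤-injective; opposite-prop; opposite-involutive;
         combine-injectiveˡ; combine-injectiveʳ; funToFin-finToFin; finToFun-funToFin)
open import Data.Integer as ℤ using (ℤ; +_; _⊖_)
import Data.Integer.Properties as ℤₚ
import Data.Integer.Tactic.RingSolver as ℤ-Solver
open import Data.Nat using (zero; suc; _*_; ∣_-_∣; s≤s; s≤s⁻¹; z≤n; _<?_; _≤?_; NonZero)
open import Data.Nat.Properties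
open import Algebra.Properties.Semiring.Sum +-*-semiring
  using (sum; sum-syntax; sum-cong-≗; ∑-distrib-+; *-distribˡ-sum)
open import Data.Nat.Tactic.RingSolver using (solve-∀)
open import Data.Product using (_,_)
open import Data.Sum using ([_,_]′)
open import Function using (_∘_; id)
open import Relation.Binary.PropositionalEquality
open import Relation.Nullary using (yes; no)

sqDiff : ℕ → ℕ → ℕ
sqDiff a b = ∣ a - b ∣ * ∣ a - b ∣

dist² : ∀ {m} → (Fin m → ℕ) → (Fin m → ℕ) → ℕ
dist² {m} x y = ∑[ i < m ] sqDiff (x i) (y i)

∣⊖∣≡∣-∣ : ∀ a b → ℤ.∣ a ⊖ b ∣ ≡ ∣ a - b ∣
∣⊖∣≡∣-∣ zero    zero    = refl
∣⊖∣≡∣-∣ zero    (suc b) = refl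
∣⊖∣≡∣-∣ (suc a) zero    = refl
∣⊖∣≡∣-∣ (suc a) (suc b) = trans (cong ℤ.∣_∣ (ℤₚ.[1+m]⊖[1+n]≡m⊖n a b)) (∣⊖∣≡∣-∣ a b)

+∣i∣*+∣i∣≡i*i : ∀ i → + ℤ.∣ i ∣ ℤ.* + ℤ.∣ i ∣ ≡ i ℤ.* i
+∣i∣*+∣i∣≡i*i (+ n)    = refl
+∣i∣*+∣i∣≡i*i ℤ.-[1+ n ] = refl

+sqDiff : ∀ a b → + sqDiff a b ≡ (+ a ℤ.- + b) ℤ.* (+ a ℤ.- + b)
+sqDiff a b = begin
  + (∣ a - b ∣ * ∣ a - b ∣)          ≡⟨ ℤₚ.pos-* ∣ a - b ∣ ∣ a - b ∣ ⟩
  + ∣ a - b ∣ ℤ.* + ∣ a - b ∣        ≡⟨ cong (λ n → + n ℤ.* + n) ∣d∣≡∣a-b∣ ⟨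
  + ℤ.∣ d ∣ ℤ.* + ℤ.∣ d ∣            ≡⟨ +∣i∣*+∣i∣≡i*i d ⟩
  d ℤ.* d                            ∎
  where
  open ≡-Reasoning
  d : ℤ
  d = + a ℤ.- + b
  ∣d∣≡∣a-b∣ : ℤ.∣ d ∣ ≡ ∣ a - b ∣
  ∣d∣≡∣a-b∣ = trans (cong ℤ.∣_∣ (ℤₚ.m-n≡m⊖n a b)) (∣⊖∣≡∣-∣ a b)

+[a+2b] : ∀ a b → + (a + 2 * b) ≡ + a ℤ.+ + 2 ℤ.* + b
+[a+2b] a b = trans (ℤₚ.pos-+ a (2 * b)) (cong (ℤ._+_ (+ a)) (ℤₚ.pos-* 2 b))

parallelogramℤ : ∀ X X' Y Y' → X' ℤ.+ + 2 ℤ.* Y' ≡ X ℤ.+ + 2 ℤ.* Y →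
  + 2 ℤ.* ((Y ℤ.- X) ℤ.* (Y ℤ.- X)) ℤ.+ + 2 ℤ.* ((Y ℤ.- X') ℤ.* (Y ℤ.- X'))
    ≡ + 4 ℤ.* ((Y' ℤ.- X) ℤ.* (Y' ℤ.- X)) ℤ.+ (X ℤ.- X') ℤ.* (X ℤ.- X')
parallelogramℤ X X' Y Y' h = subst P (sym X'≡) (identity X Y Y')
  where
  P : ℤ → Set
  P U = + 2 ℤ.* ((Y ℤ.- X) ℤ.* (Y ℤ.- X)) ℤ.+ + 2 ℤ.* ((Y ℤ.- U) ℤ.* (Y ℤ.- U))
          ≡ + 4 ℤ.* ((Y' ℤ.- X) ℤ.* (Y' ℤ.- X)) ℤ.+ (X ℤ.- U) ℤ.* (X ℤ.- U)
  X'≡ : X' ≡ X ℤ.+ + 2 ℤ.* Y ℤ.- + 2 ℤ.* Y'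
  X'≡ = trans (cancel X' (+ 2 ℤ.* Y')) (cong (ℤ._- + 2 ℤ.* Y') h)
    where
    cancel : ∀ u v → u ≡ u ℤ.+ v ℤ.- v
    cancel = ℤ-Solver.solve-∀
  identity : ∀ X Y Y' →
    + 2 ℤ.* ((Y ℤ.- X) ℤ.* (Y ℤ.- X))
      ℤ.+ + 2 ℤ.* ((Y ℤ.- (X ℤ.+ + 2 ℤ.* Y ℤ.- + 2 ℤ.* Y')) ℤ.* (Y ℤ.- (X ℤ.+ + 2 ℤ.* Y ℤ.- + 2 ℤ.* Y')))
    ≡ + 4 ℤ.* ((Y' ℤ.- X) ℤ.* (Y' ℤ.- X))
      ℤ.+ (X ℤ.- (X ℤ.+ + 2 ℤ.* Y ℤ.- + 2 ℤ.* Y')) ℤ.* (X ℤ.- (X ℤ.+ + 2 ℤ.* Y ℤ.- + 2 ℤ.* Y'))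
  identity = ℤ-Solver.solve-∀

-- Since 2 (y' - x) = (y - x) + (y - x'), this is the parallelogram law for y - x and y - x'.
sqDiff-parallelogram : ∀ x x' y y' → x' + 2 * y' ≡ x + 2 * y →
  2 * sqDiff y x + 2 * sqDiff y x' ≡ 4 * sqDiff y' x + sqDiff x x'
sqDiff-parallelogram x x' y y' h = ℤₚ.+-injective (begin
  + (2 * sqDiff y x + 2 * sqDiff y x')
    ≡⟨ ℤₚ.pos-+ (2 * sqDiff y x) (2 * sqDiff y x') ⟩
  + (2 * sqDiff y x) ℤ.+ + (2 * sqDiff y x')
    ≡⟨ cong₂ ℤ._+_ (ℤₚ.pos-* 2 (sqDiff y x)) (ℤₚ.pos-* 2 (sqDiff y x')) ⟩
  + 2 ℤ.* + sqDiff y x ℤ.+ + 2 ℤ.* + sqDiff y x'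
    ≡⟨ cong₂ (λ a b → + 2 ℤ.* a ℤ.+ + 2 ℤ.* b) (+sqDiff y x) (+sqDiff y x') ⟩
  + 2 ℤ.* ((+ y ℤ.- + x) ℤ.* (+ y ℤ.- + x)) ℤ.+ + 2 ℤ.* ((+ y ℤ.- + x') ℤ.* (+ y ℤ.- + x'))
    ≡⟨ parallelogramℤ (+ x) (+ x') (+ y) (+ y') hℤ ⟩
  + 4 ℤ.* ((+ y' ℤ.- + x) ℤ.* (+ y' ℤ.- + x)) ℤ.+ (+ x ℤ.- + x') ℤ.* (+ x ℤ.- + x')
    ≡⟨ cong₂ (λ a b → + 4 ℤ.* a ℤ.+ b) (+sqDiff y' x) (+sqDiff x x') ⟨
  + 4 ℤ.* + sqDiff y' x ℤ.+ + sqDiff x x'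
    ≡⟨ cong (λ u → u ℤ.+ + sqDiff x x') (ℤₚ.pos-* 4 (sqDiff y' x)) ⟨
  + (4 * sqDiff y' x) ℤ.+ + sqDiff x x'
    ≡⟨ ℤₚ.pos-+ (4 * sqDiff y' x) (sqDiff x x') ⟨
  + (4 * sqDiff y' x + sqDiff x x') ∎)
  where
  open ≡-Reasoning
  hℤ : + x' ℤ.+ + 2 ℤ.* + y' ≡ + x ℤ.+ + 2 ℤ.* + y
  hℤ = trans (sym (+[a+2b] x' y')) (trans (cong +_ h) (+[a+2b] x y))

sum≡0⇒≗0 : ∀ {m} (f : Fin m → ℕ) → sum f ≡ 0 → ∀ i → f i ≡ 0
sum≡0⇒≗0 f h zero    = m+n≡0⇒m≡0 (f zero) h
sum≡0⇒≗0 f h (suc i) = sum≡0⇒≗0 (f ∘ suc) (m+n≡0⇒n≡0 (f zero) h) i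

sum≤m*b : ∀ {m b} (f : Fin m → ℕ) → (∀ i → f i ≤ b) → sum f ≤ m * b
sum≤m*b {zero}  f f≤b = z≤n
sum≤m*b {suc m} f f≤b = +-mono-≤ (f≤b zero) (sum≤m*b (f ∘ suc) (f≤b ∘ suc))

dist²-parallelogram : ∀ {m} (x x' y y' : Fin m → ℕ) → (∀ i → x' i + 2 * y' i ≡ x i + 2 * y i) →
  2 * dist² y x + 2 * dist² y x' ≡ 4 * dist² y' x + dist² x x'
dist²-parallelogram {m} x x' y y' h = begin
  2 * dist² y x + 2 * dist² y x'
    ≡⟨ cong₂ _+_ (*-distribˡ-sum 2 (λ i → sqDiff (y i) (x i)))
                 (*-distribˡ-sum 2 (λ i → sqDiff (y i) (x' i))) ⟩
  ∑[ i < m ] (2 * sqDiff (y i) (x i)) + ∑[ i < m ] (2 * sqDiff (y i) (x' i))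
    ≡⟨ ∑-distrib-+ (λ i → 2 * sqDiff (y i) (x i)) (λ i → 2 * sqDiff (y i) (x' i)) ⟨
  ∑[ i < m ] (2 * sqDiff (y i) (x i) + 2 * sqDiff (y i) (x' i))
    ≡⟨ sum-cong-≗ (λ i → sqDiff-parallelogram (x i) (x' i) (y i) (y' i) (h i)) ⟩
  ∑[ i < m ] (4 * sqDiff (y' i) (x i) + sqDiff (x i) (x' i))
    ≡⟨ ∑-distrib-+ (λ i → 4 * sqDiff (y' i) (x i)) (λ i → sqDiff (x i) (x' i)) ⟩
  ∑[ i < m ] (4 * sqDiff (y' i) (x i)) + dist² x x'
    ≡⟨ cong (_+ dist² x x') (*-distribˡ-sum 4 (λ i → sqDiff (y' i) (x i))) ⟨
  4 * dist² y' x + dist² x x' ∎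
  where open ≡-Reasoning

dist²≡0⇒≗ : ∀ {m} (x y : Fin m → ℕ) → dist² x y ≡ 0 → x ≗ y
dist²≡0⇒≗ x y h i = ∣m-n∣≡0⇒m≡n ([ id , id ]′ (m*n≡0⇒m≡0∨n≡0 _ (sum≡0⇒≗0 _ h i)))

equidistant⇒≗ : ∀ {m} (x x' y y' : Fin m → ℕ) → (∀ i → x' i + 2 * y' i ≡ x i + 2 * y i) →
  dist² y x ≡ dist² y x' → dist² y x ≡ dist² y' x → x ≗ x'
equidistant⇒≗ x x' y y' h e e' = dist²≡0⇒≗ x x' (+-cancelˡ-≡ (4 * r) _ _ (begin
  4 * r + dist² x x'               ≡⟨ cong (λ d → 4 * d + dist² x x') e' ⟩
  4 * dist² y' x + dist² x x'      ≡⟨ dist²-parallelogram x x' y y' h ⟨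
  2 * r + 2 * dist² y x'           ≡⟨ cong (λ d → 2 * r + 2 * d) e ⟨
  2 * r + 2 * r                    ≡⟨ double r ⟩
  4 * r + 0                        ∎))
  where
  open ≡-Reasoning
  r : ℕ
  r = dist² y x
  double : ∀ r → 2 * r + 2 * r ≡ 4 * r + 0
  double = solve-∀

sqDiff≤ : ∀ {a b n} → a < n → b < n → sqDiff a b ≤ n * n
sqDiff≤ {a} {b} {n} a<n b<n = *-mono-≤ ∣a-b∣≤n ∣a-b∣≤n
  where
  ∣a-b∣≤n : ∣ a - b ∣ ≤ n
  ∣a-b∣≤n = ≤-trans (∣m-n∣≤m⊔n a b) (⊔-lub (<⇒≤ a<n) (<⇒≤ b<n))

opposite-+-suc : ∀ {n} (i : Fin n) → toℕ (opposite i) + suc (toℕ i) ≡ n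
opposite-+-suc i = trans (cong (_+ suc (toℕ i)) (opposite-prop i)) (m∸n+n≡m (toℕ<n i))

-- The coordinate a - 2b + c, shifted by 2 (n - 1) so that no subtraction occurs.
lineCoord : ∀ {n} → Fin n → Fin n → Fin n → ℕ
lineCoord a b c = toℕ a + 2 * toℕ (opposite b) + toℕ c

lineCoord<4n : ∀ {n} (a b c : Fin n) → lineCoord a b c < 4 * n
lineCoord<4n {n} a b c = <-≤-trans
  (+-mono-< (+-mono-< (toℕ<n a) (*-monoʳ-< 2 (toℕ<n (opposite b)))) (toℕ<n c))
  (≤-reflexive (four n))
  where
  four : ∀ n → n + 2 * n + n ≡ 4 * n
  four = solve-∀

lineCoord-injective₁ : ∀ {n} {a a' : Fin n} (b c : Fin n) → lineCoord a b c ≡ lineCoord a' b c → a ≡ a'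
lineCoord-injective₁ {a = a} {a'} b c h =
  toℕ-injective (+-cancelʳ-≡ (2 * toℕ (opposite b)) (toℕ a) (toℕ a') (+-cancelʳ-≡ (toℕ c) _ _ h))

lineCoord-injective₃ : ∀ {n} (a b : Fin n) {c c' : Fin n} → lineCoord a b c ≡ lineCoord a b c' → c ≡ c'
lineCoord-injective₃ a b h = toℕ-injective (+-cancelˡ-≡ (toℕ a + 2 * toℕ (opposite b)) _ _ h)

lineCoord-injective₂ : ∀ {n} (a : Fin n) {b b' : Fin n} (c : Fin n) → lineCoord a b c ≡ lineCoord a b' c → b ≡ b'
lineCoord-injective₂ a {b} {b'} c h = begin
  b                       ≡⟨ opposite-involutive b ⟨
  opposite (opposite b)   ≡⟨ cong opposite ob≡ob' ⟩
  opposite (opposite b')  ≡⟨ opposite-involutive b' ⟩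
  b'                      ∎
  where
  open ≡-Reasoning
  ob≡ob' : opposite b ≡ opposite b'
  ob≡ob' = toℕ-injective (*-cancelˡ-≡ _ _ 2 (+-cancelˡ-≡ (toℕ a) _ _ (+-cancelʳ-≡ (toℕ c) _ _ h)))

-- Reading w = n - 1 - v and w' = n - 1 - v', the hypothesis says u' - 2v = u - 2v'.
reflect-transfer : ∀ {n u u' v v' w w'} → w + suc v ≡ n → w' + suc v' ≡ n →
  u' + 2 * w ≡ u + 2 * w' → u' + 2 * v' ≡ u + 2 * v
reflect-transfer {n} {u} {u'} {v} {v'} {w} {w'} wv wv' h = +-cancelʳ-≡ (2 * n) _ _ (begin
  u' + 2 * v' + 2 * n                 ≡⟨ cong (λ k → u' + 2 * v' + 2 * k) wv ⟨
  u' + 2 * v' + 2 * (w + suc v)       ≡⟨ swap u' v' w v ⟩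
  u' + 2 * w + 2 * (v' + suc v)       ≡⟨ cong (_+ 2 * (v' + suc v)) h ⟩
  u + 2 * w' + 2 * (v' + suc v)       ≡⟨ swap' u w' v' v ⟩
  u + 2 * v + 2 * (w' + suc v')       ≡⟨ cong (λ k → u + 2 * v + 2 * k) wv' ⟩
  u + 2 * v + 2 * n                   ∎)
  where
  open ≡-Reasoning
  swap : ∀ a b c d → a + 2 * b + 2 * (c + suc d) ≡ a + 2 * c + 2 * (b + suc d)
  swap = solve-∀
  swap' : ∀ a b c d → a + 2 * b + 2 * (c + suc d) ≡ a + 2 * d + 2 * (b + suc c)
  swap' = solve-∀

lineCoord-midpoint : ∀ {n} (a a' b b' c : Fin n) → lineCoord a' b c ≡ lineCoord a b' c →
  toℕ a' + 2 * toℕ b' ≡ toℕ a + 2 * toℕ b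
lineCoord-midpoint a a' b b' c h =
  reflect-transfer {u = toℕ a} {toℕ a'} (opposite-+-suc b) (opposite-+-suc b') (+-cancelʳ-≡ (toℕ c) _ _ h)

funToFin-cong : ∀ {m n} {f g : Fin m → Fin n} → f ≗ g → funToFin f ≡ funToFin g
funToFin-cong {zero}  f≗g = refl
funToFin-cong {suc m} f≗g = cong₂ combine (f≗g zero) (funToFin-cong (f≗g ∘ suc))

funToFin-injective : ∀ {m n} (f g : Fin m → Fin n) → funToFin f ≡ funToFin g → f ≗ g
funToFin-injective f g h i =
  trans (sym (finToFun-funToFin f i)) (trans (cong (λ k → finToFun k i) h) (finToFun-funToFin g i))

finToFun-injective : ∀ {m n} (k l : Fin (n ^ m)) → finToFun {n} {m} k ≗ finToFun l → k ≡ l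
finToFun-injective {m} k l h =
  trans (sym (funToFin-finToFin {m} k)) (trans (funToFin-cong h) (funToFin-finToFin {m} l))

radius : ∀ {n m} → (Fin m → Fin n) → (Fin m → Fin n) → ℕ
radius x y = dist² (toℕ ∘ y) (toℕ ∘ x)

radius≤ : ∀ {n m} (x y : Fin m → Fin n) → radius x y ≤ m * (n * n)
radius≤ x y = sum≤m*b _ (λ i → sqDiff≤ (toℕ<n (y i)) (toℕ<n (x i)))

colourCount : ℕ → ℕ → ℕ
colourCount n m = suc (m * (n * n)) * (4 * n) ^ m

radiusDigit : ∀ {n m} (x y : Fin m → Fin n) → Fin (suc (m * (n * n)))
radiusDigit x y = fromℕ< (s≤s (radius≤ x y))

lineDigits : ∀ {n m} (x y z : Fin m → Fin n) → Fin m → Fin (4 * n)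
lineDigits x y z i = fromℕ< (lineCoord<4n (x i) (y i) (z i))

colour : ∀ {n m} (x y z : Fin m → Fin n) → Fin (colourCount n m)
colour x y z = combine (radiusDigit x y) (funToFin (lineDigits x y z))

module _ {n m} (x y z x' y' z' : Fin m → Fin n) (same : colour x y z ≡ colour x' y' z') where

  colour⇒radius : radius x y ≡ radius x' y'
  colour⇒radius = fromℕ<-injective _ _ _ _
    (combine-injectiveˡ (radiusDigit x y) _ (radiusDigit x' y') _ same)

  colour⇒lineCoord : ∀ i → lineCoord (x i) (y i) (z i) ≡ lineCoord (x' i) (y' i) (z' i)
  colour⇒lineCoord i = fromℕ<-injective _ _ _ _
    (funToFin-injective (lineDigits x y z) (lineDigits x' y' z')
      (combine-injectiveʳ (radiusDigit x y) _ (radiusDigit x' y') _ same) i)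

module _ {N n m} (d : Fin N → Fin m → Fin n) (d-injective : ∀ i j → d i ≗ d j → i ≡ j) where

  mmColour : Fin N × Fin N × Fin N → Fin (colourCount n m)
  mmColour (i , j , k) = colour (d i) (d j) (d k)

  mmColour-independent : ∀ κ → Independent (MM N) (λ t → mmColour t ≡ κ)
  mmColour-independent κ = record
    { unique₁ = unique₁ ; unique₂ = unique₂ ; unique₃ = unique₃ ; closed = closed }
    where
    open TensorSupport (MM N) using (π₁; π₂; π₃)

    unique₁ : ∀ s t → mmColour s ≡ κ → mmColour t ≡ κ → π₁ s ≡ π₁ t → s ≡ t
    unique₁ (i , j , k) (.i , .j , k') cs ct refl = cong (λ k → i , j , k) (d-injective k k' λ l →
      lineCoord-injective₃ (d i l) (d j l)
        (colour⇒lineCoord (d i) (d j) (d k) (d i) (d j) (d k') (trans cs (sym ct)) l))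

    unique₂ : ∀ s t → mmColour s ≡ κ → mmColour t ≡ κ → π₂ s ≡ π₂ t → s ≡ t
    unique₂ (i , j , k) (i' , .j , .k) cs ct refl = cong (λ i → i , j , k) (d-injective i i' λ l →
      lineCoord-injective₁ (d j l) (d k l)
        (colour⇒lineCoord (d i) (d j) (d k) (d i') (d j) (d k) (trans cs (sym ct)) l))

    unique₃ : ∀ s t → mmColour s ≡ κ → mmColour t ≡ κ → π₃ s ≡ π₃ t → s ≡ t
    unique₃ (i , j , k) (.i , j' , .k) cs ct refl = cong (λ j → i , j , k) (d-injective j j' λ l →
      lineCoord-injective₂ (d i l) (d k l)
        (colour⇒lineCoord (d i) (d j) (d k) (d i) (d j') (d k) (trans cs (sym ct)) l))

    closed : ∀ t → ∃[ s ] (mmColour s ≡ κ × π₁ s ≡ π₁ t) → ∃[ s ] (mmColour s ≡ κ × π₂ s ≡ π₂ t) →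
      ∃[ s ] (mmColour s ≡ κ × π₃ s ≡ π₃ t) → mmColour t ≡ κ
    closed (i , j , k) ((.i , .j , k₁) , c₁ , refl) ((i₂ , .j , .k) , c₂ , refl) ((.i , j₃ , .k) , c₃ , refl) =
      subst (λ i' → mmColour (i' , j , k) ≡ κ) (sym i≡i₂) c₂
      where
      x x₂ y y₃ : Fin _ → ℕ
      x = toℕ ∘ d i ; x₂ = toℕ ∘ d i₂ ; y = toℕ ∘ d j ; y₃ = toℕ ∘ d j₃
      midpoint : ∀ l → x₂ l + 2 * y₃ l ≡ x l + 2 * y l
      midpoint l = lineCoord-midpoint (d i l) (d i₂ l) (d j l) (d j₃ l) (d k l)
        (colour⇒lineCoord (d i₂) (d j) (d k) (d i) (d j₃) (d k) (trans c₂ (sym c₃)) l)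
      i≡i₂ : i ≡ i₂
      i≡i₂ = d-injective i i₂ (toℕ-injective ∘ equidistant⇒≗ x x₂ y y₃ midpoint
        (colour⇒radius (d i) (d j) (d k₁) (d i₂) (d j) (d k) (trans c₁ (sym c₂)))
        (colour⇒radius (d i) (d j) (d k₁) (d i) (d j₃) (d k) (trans c₁ (sym c₃))))

  mmColour-partition : PartitionableInto (MM N) (colourCount n m)
  mmColour-partition = mmColour , mmColour-independent

digits : ∀ {N} n m → N ≤ n ^ m → Fin N → Fin m → Fin n
digits n m N≤n^m i = finToFun (inject≤ i N≤n^m)

digits-injective : ∀ {N} n m (N≤n^m : N ≤ n ^ m) i j → digits n m N≤n^m i ≗ digits n m N≤n^m j → i ≡ j
digits-injective n m N≤n^m i j h = inject≤-injective N≤n^m N≤n^m i j (finToFun-injective {m} {n} _ _ h)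

mm-partition-≤^ : ∀ {N} n m → N ≤ n ^ m → PartitionableInto (MM N) (colourCount n m)
mm-partition-≤^ n m N≤n^m = mmColour-partition (digits n m N≤n^m) (digits-injective n m N≤n^m)

n<2^n : ∀ n → n < 2 ^ n
n<2^n zero    = s≤s z≤n
n<2^n (suc n) = ≤-trans (+-mono-≤ (m^n>0 2 n) (n<2^n n))
                        (≤-reflexive (cong (_+_ (2 ^ n)) (sym (+-identityʳ (2 ^ n)))))

^-cancelˡ-< : ∀ b .{{_ : NonZero b}} {e f} → b ^ e < b ^ f → e < f
^-cancelˡ-< b {e} {f} b^e<b^f with e <? f
... | yes e<f = e<f
... | no  e≮f = ⊥-elim (<⇒≱ b^e<b^f (^-monoʳ-≤ b (≮⇒≥ e≮f)))

exponent-bracket : ∀ {b N} → 2 ≤ b → 1 < N → ∃[ m ] (b ^ m < N × N ≤ b ^ suc m)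
exponent-bracket {b} {N} 2≤b 1<N = search N (<⇒≤ (<-≤-trans (n<2^n N) (^-monoˡ-≤ N 2≤b)))
  where
  search : ∀ e → N ≤ b ^ e → ∃[ m ] (b ^ m < N × N ≤ b ^ suc m)
  search zero    N≤1 = ⊥-elim (<⇒≱ 1<N N≤1)
  search (suc e) N≤b^[1+e] with N ≤? b ^ e
  ... | yes N≤b^e = search e N≤b^e
  ... | no  N≰b^e = e , ≰⇒> N≰b^e , N≤b^[1+e]

colourCount-2^ : ∀ c m → colourCount (2 ^ c) m ≤ 2 ^ (m + (c + c) + (2 + c) * m)
colourCount-2^ c m = begin
  suc (m * (L * L)) * (4 * L) ^ m
    ≤⟨ *-monoˡ-≤ ((4 * L) ^ m) radii≤ ⟩
  2 ^ m * (L * L) * (4 * L) ^ m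
    ≡⟨ cong₂ (λ a b → 2 ^ m * a * b ^ m) (^-distribˡ-+-* 2 c c) (sym (*-assoc 2 2 L)) ⟨
  2 ^ m * 2 ^ (c + c) * (2 ^ (2 + c)) ^ m
    ≡⟨ cong₂ _*_ (sym (^-distribˡ-+-* 2 m (c + c))) (^-*-assoc 2 (2 + c) m) ⟩
  2 ^ (m + (c + c)) * 2 ^ ((2 + c) * m)
    ≡⟨ ^-distribˡ-+-* 2 (m + (c + c)) ((2 + c) * m) ⟨
  2 ^ (m + (c + c) + (2 + c) * m) ∎
  where
  open ≤-Reasoning
  L : ℕ
  L = 2 ^ c
  radii≤ : suc (m * (L * L)) ≤ 2 ^ m * (L * L)
  radii≤ = ≤-trans (+-monoˡ-≤ (m * (L * L)) (*-mono-≤ (m^n>0 2 c) (m^n>0 2 c)))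
                   (*-monoˡ-≤ (L * L) (n<2^n m))

exponent-slack : ∀ q p m → 0 < p → 12 * q + 3 ≤ m →
  (suc m + (4 * q + 4 * q) + (2 + 4 * q) * suc m) * q ≤ 4 * q * m * (q + p)
exponent-slack q (suc p) m _ 12q+3≤m with m≤n⇒∃[o]m+o≡n 12q+3≤m
... | t , refl = ≤-trans (m≤m+n _ (q * t + 4 * q * (12 * q + 3 + t) * p)) (≤-reflexive (identity q p t))
  where
  identity : ∀ q p t →
    (suc (12 * q + 3 + t) + (4 * q + 4 * q) + (2 + 4 * q) * suc (12 * q + 3 + t)) * q
      + (q * t + 4 * q * (12 * q + 3 + t) * p)
    ≡ 4 * q * (12 * q + 3 + t) * (q + suc p)
  identity = solve-∀

colourCount^q≤ : ∀ q {p m N} → 0 < p → 12 * q + 3 ≤ m → (2 ^ (4 * q)) ^ m ≤ N →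
  colourCount (2 ^ (4 * q)) (suc m) ^ q ≤ N ^ (q + p)
colourCount^q≤ q {p} {m} {N} 0<p 12q+3≤m L^m≤N = begin
  colourCount (2 ^ c) (suc m) ^ q   ≤⟨ ^-monoˡ-≤ q (colourCount-2^ c (suc m)) ⟩
  (2 ^ E) ^ q                       ≡⟨ ^-*-assoc 2 E q ⟩
  2 ^ (E * q)                       ≤⟨ ^-monoʳ-≤ 2 (exponent-slack q p m 0<p 12q+3≤m) ⟩
  2 ^ (c * m * (q + p))             ≡⟨ ^-*-assoc 2 (c * m) (q + p) ⟨
  (2 ^ (c * m)) ^ (q + p)           ≡⟨ cong (_^ (q + p)) (^-*-assoc 2 c m) ⟨
  ((2 ^ c) ^ m) ^ (q + p)           ≤⟨ ^-monoˡ-≤ (q + p) L^m≤N ⟩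
  N ^ (q + p)                       ∎
  where
  open ≤-Reasoning
  c E : ℕ
  c = 4 * q
  E = suc m + (c + c) + (2 + c) * suc m

mainTheorem5 : ∀ (p q : ℕ) → 0 < p → 0 < q →
    ∃[ N₀ ] ∀ (N : ℕ) → N₀ ≤ N →
      ∃[ k ] ((k ^ q ≤ N ^ (q + p)) × PartitionableInto (MM N) k)
mainTheorem5 p q 0<p 0<q = suc (L ^ (12 * q + 3)) , partition
  where
  L : ℕ
  L = 2 ^ (4 * q)
  2≤L : 2 ≤ L
  2≤L = ^-monoʳ-≤ 2 (≤-trans 0<q (m≤n*m q 4))
  instance
    L≢0 : NonZero L
    L≢0 = m^n≢0 2 (4 * q)
  partition : ∀ N → suc (L ^ (12 * q + 3)) ≤ N →
    ∃[ k ] ((k ^ q ≤ N ^ (q + p)) × PartitionableInto (MM N) k)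
  partition N L^n₀<N with exponent-bracket 2≤L (<-≤-trans (s≤s (m^n>0 L (12 * q + 3))) L^n₀<N)
  ... | m , L^m<N , N≤L^[1+m] =
    colourCount L (suc m) , colourCount^q≤ q 0<p n₀≤m (<⇒≤ L^m<N) , mm-partition-≤^ L (suc m) N≤L^[1+m]
    where
    n₀≤m : 12 * q + 3 ≤ m
    n₀≤m = s≤s⁻¹ (^-cancelˡ-< L (<-≤-trans L^n₀<N N≤L^[1+m]))
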